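{- Let $G$ be a non-collinear visibility graph. Then the edge-connectivity of $G$ equals its minimum degree. Moreover, for any distinct vertices $v$ and $w$ of $G$, there are $\min\{\deg(v),\deg(w)\}$ pairwise edge-disjoint paths of length at most $4$ between $v$ and $w$ in $G$.
   Context: For a finite set $P$ of points in the plane, two distinct points $v,w$ are visible with respect to $P$ if no point of $P$ lies in the open line segment $vw$. The visibility graph of $P$ has vertex set $P$, with $v,w$ adjacent iff they are visible with respect to $P$. A visibility graph is non-collinear if its vertex set (the point set $P$) does not lie on a single line. -}

module Defs where

open import Level using (0ℓ)
open import Data.Nat using (ℕ; zero; suc; _⊓_) renaming (_≤_ to _≤ℕ_; _<_ to _<ℕ_)
open import Data.Fin using (Fin; zero; suc; inject₁; fromℕ)
open import Data.Product using (Σ; ∃; ∃-syntax; _×_; _,_; proj₁; proj₂)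
open import Data.Sum using (_⊎_)
open import Data.List using (List; length)
open import Data.List.Membership.Propositional using (_∈_; _∉_)
open import Data.List.Relation.Unary.Unique.Propositional using (Unique)
open import Relation.Nullary using (¬_)
open import Relation.Binary.PropositionalEquality using (_≡_; _≢_)
open import Algebra.Structures using (IsCommutativeRing)
open import Function using (_⇔_)

-- The real numbers, given axiomatically as a complete ordered field
-- (any model; all models are isomorphic to ℝ).

record RealField : Set₁ where
  infixl 6 _+_
  infixl 7 _*_
  infix  4 _<_
  field
    R     : Set
    0# 1# : R
    _+_ _*_ : R → R → R
    -_    : R → R
    _<_   : R → R → Set
    isCommutativeRing : IsCommutativeRing _≡_ _+_ _*_ -_ 0# 1#
    0≢1     : 0# ≢ 1#
    inverse : ∀ x → x ≢ 0# → ∃[ y ] (x * y ≡ 1#)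
    <-irrefl : ∀ x → ¬ (x < x)
    <-trans  : ∀ {x y z} → x < y → y < z → x < z
    <-trichotomy : ∀ x y → x < y ⊎ x ≡ y ⊎ y < x
    +-mono-<  : ∀ {x y} z → x < y → x + z < y + z
    *-pos     : ∀ {x y} → 0# < x → 0# < y → 0# < x * y
    complete : (S : R → Set) → (∃[ x ] S x) → (∃[ b ] (∀ x → S x → x < b ⊎ x ≡ b)) →
               ∃[ s ] ((∀ x → S x → x < s ⊎ x ≡ s) ×
                       (∀ b → (∀ x → S x → x < b ⊎ x ≡ b) → s < b ⊎ s ≡ b))

module Plane (ℝ : RealField) where
  open RealField ℝ

  Point : Set
  Point = R × R

  _-ʳ_ : R → R → R
  x -ʳ y = x + (- y)

  InOpenSegment : Point → Point → Point → Set
  InOpenSegment (px , py) (ax , ay) (bx , by) =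
    ∃[ t ] (0# < t × t < 1# ×
            px ≡ ax + t * (bx -ʳ ax) × py ≡ ay + t * (by -ʳ ay))

  -- three points are collinear (cross product vanishes)
  Collinear₃ : Point → Point → Point → Set
  Collinear₃ (ax , ay) (bx , by) (cx , cy) =
    (bx -ʳ ax) * (cy -ʳ ay) ≡ (by -ʳ ay) * (cx -ʳ ax)

-- Point sets: a finite set P of n points, given as an injective map
-- Fin n → Point.

module PointSet (ℝ : RealField) {n : ℕ} (P : Fin n → Plane.Point ℝ) where
  open Plane ℝ

  Visible : Fin n → Fin n → Set
  Visible v w = v ≢ w × (∀ k → ¬ InOpenSegment (P k) (P v) (P w))

  NonCollinear : Set
  NonCollinear = ∃[ i ] ∃[ j ] ∃[ k ] ¬ Collinear₃ (P i) (P j) (P k)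

module Graph {n : ℕ} (Adj : Fin n → Fin n → Set) where

  HasDegree : Fin n → ℕ → Set
  HasDegree v d = ∃[ ns ] (Unique ns × length ns ≡ d × (∀ w → w ∈ ns ⇔ Adj v w))

  MinDegree : ℕ → Set
  MinDegree δ = (∃[ v ] HasDegree v δ) × (∀ v d → HasDegree v d → δ ≤ℕ d)

  Delete : List (Fin n × Fin n) → Fin n → Fin n → Set
  Delete F a b = Adj a b × (a , b) ∉ F × (b , a) ∉ F

  data Reachable (A : Fin n → Fin n → Set) : Fin n → Fin n → Set where
    here : ∀ {a} → Reachable A a a
    step : ∀ {a b c} → A a b → Reachable A b c → Reachable A a c

  Connected : (Fin n → Fin n → Set) → Set
  Connected A = ∀ a b → Reachable A a b

  EdgeConnectivity : ℕ → Set
  EdgeConnectivity k =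
    (∀ (F : List (Fin n × Fin n)) → length F <ℕ k → Connected (Delete F)) ×
    (∃[ F ] (length F ≡ k × (∀ e → e ∈ F → Adj (proj₁ e) (proj₂ e))
                          × ¬ Connected (Delete F)))

  record Path (v w : Fin n) : Set where
    field
      len    : ℕ
      vert   : Fin (suc len) → Fin n
      inj    : ∀ i j → vert i ≡ vert j → i ≡ j
      start  : vert zero ≡ v
      end    : vert (fromℕ len) ≡ w
      adj    : ∀ (i : Fin len) → Adj (vert (inject₁ i)) (vert (suc i))

  open Path

  UsesEdge : ∀ {v w} → Path v w → Fin n → Fin n → Set
  UsesEdge p a b = ∃[ i ] ((vert p (inject₁ i) ≡ a × vert p (suc i) ≡ b) ⊎
                           (vert p (inject₁ i) ≡ b × vert p (suc i) ≡ a))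

  EdgeDisjoint : ∀ {v w} → Path v w → Path v w → Set
  EdgeDisjoint p q = ∀ a b → UsesEdge p a b → ¬ UsesEdge q a b

-- A non-collinear point set has a visibility graph of diameter two: for distinct a and b, a point c
-- off the line ab with minimal distance to it sees both a and b, because a point strictly between
-- c and a (or c and b) would be closer to the line.  In a graph of diameter two, distinct v and w
-- are joined by min(deg v, deg w) edge-disjoint paths of length at most four: the edge vw, the
-- paths v–x–w through common neighbours, paths v–a–b–w along a maximal matching between the
-- private neighbours of v and of w (those that are neither the other vertex nor adjacent to it),
-- and paths v–a–c–b–w through a common neighbour c of paired unmatched private neighbours a, b.
-- Deleting fewer edges than there are such paths leaves one of them intact, while the edges at a
-- vertex of minimum degree form a cut, so the edge-connectivity is the minimum degree.

module Submission where

open import Defs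
open import Data.Nat using (ℕ; _⊓_; _≤_)
open import Data.Fin using (Fin)
open import Data.Product using (Σ; _×_; _,_; proj₂; map₂)
open import Relation.Binary.PropositionalEquality using (_≡_; _≢_)
open import Algebra.Bundles using (CommutativeRing)

module Graphs where

  open import Data.Nat using (ℕ; zero; suc; _+_; _⊓_; _≤_; _<_; z≤n; s≤s)
  open import Data.Nat.Properties
    using (module ≤-Reasoning; ≤-refl; ≤-trans; ≤-reflexive; <-≤-trans; <-irrefl; m≤m+n; ⊓-glb; ⊓-mono-≤;
           +-mono-≤; +-distribˡ-⊓)
  open import Data.Fin as Fin using (Fin; zero; suc; inject₁; fromℕ; inject≤)
  open import Data.Fin.Properties using (_≟_; any?; pigeonhole; inject≤-injective)
  open import Data.Product using (Σ; ∃; ∃₂; ∃-syntax; _×_; _,_; proj₁; proj₂)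
  open import Data.Sum using (_⊎_; inj₁; inj₂; swap)
  open import Data.Unit using (⊤; tt)
  open import Data.Empty using (⊥; ⊥-elim)
  open import Data.List using (List; []; _∷_; [_]; _++_; length; map; filter; allFin; lookup)
  open import Data.List.Properties using (length-map; length-++; map-++; map-∘; ++-assoc)
  open import Data.List.Membership.Propositional using (_∈_; lose; find)
  open import Data.List.Membership.Propositional.Properties
    using (∈-map⁺; ∈-map⁻; ∈-filter⁺; ∈-filter⁻; ∈-allFin; ∈-∃++; ∈-++⁺ˡ; ∈-++⁺ʳ; ∈-++⁻; ∈-lookup)
  open import Data.List.Relation.Unary.Any as Any using (here; there)
  open import Data.List.Relation.Unary.Any.Properties using (lookup-index)
  open import Data.List.Relation.Unary.All as All using (All; []; _∷_)
  open import Data.List.Relation.Unary.All.Properties using (All¬⇒¬Any)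
  import Data.List.Relation.Unary.All.Properties as All
  open import Data.List.Relation.Unary.AllPairs using ([]; _∷_)
  open import Data.List.Relation.Unary.Unique.Propositional using (Unique)
  import Data.List.Relation.Unary.Unique.Propositional.Properties as Unique
  open import Data.List.Relation.Binary.Permutation.Propositional
    using (_↭_; prep; ↭-refl; ↭-sym; ↭-trans; ↭⇒↭ₛ)
  open import Data.List.Relation.Binary.Permutation.Propositional.Properties
    using (shift; ↭-length; ∈-resp-↭; ++⁺ˡ)
  import Data.List.Relation.Binary.Permutation.Setoid.Properties as Permutationₛ
  open import Data.Vec as Vec using (Vec; []; _∷_)
  open import Data.Vec.Relation.Unary.All using ([]; _∷_)
  open import Data.Vec.Relation.Unary.AllPairs using ([]; _∷_)
  open import Data.Vec.Relation.Unary.Linked using (Linked; []; [-]; _∷_)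
  import Data.Vec.Relation.Unary.Unique.Propositional as Vec
  open import Data.Vec.Relation.Unary.Unique.Propositional.Properties using (lookup-injective)
  open import Function using (_∘_; mk⇔; Equivalence)
  open import Relation.Nullary using (¬_; Dec; yes; no; ¬?; contradiction)
  open import Relation.Nullary.Decidable using (_×-dec_; _⊎-dec_; decidable-stable)
  open import Level using (0ℓ)
  open import Relation.Unary using (Pred)
  import Relation.Unary as U
  open import Relation.Unary.Properties using (∁?)
  open import Relation.Binary using (Decidable; Symmetric)
  open import Relation.Binary.PropositionalEquality
    using (_≡_; _≢_; refl; sym; trans; cong; cong₂; subst; subst₂; setoid; module ≡-Reasoning)

  module _ {A : Set} where

    filter-∁-↭ : ∀ {P : Pred A 0ℓ} (P? : U.Decidable P) xs → filter P? xs ++ filter (∁? P?) xs ↭ xs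
    filter-∁-↭ P? [] = ↭-refl
    filter-∁-↭ P? (x ∷ xs) with P? x
    ... | yes _ = prep x (filter-∁-↭ P? xs)
    ... | no _ = ↭-trans (shift x (filter P? xs) _) (prep x (filter-∁-↭ P? xs))

    Unique-resp-↭ : ∀ {xs ys : List A} → xs ↭ ys → Unique xs → Unique ys
    Unique-resp-↭ σ = Permutationₛ.Unique-resp-↭ (setoid A) (↭⇒↭ₛ σ)

    Unique-++⁻ˡ : ∀ (xs : List A) {ys} → Unique (xs ++ ys) → Unique xs
    Unique-++⁻ˡ [] _ = []
    Unique-++⁻ˡ (x ∷ xs) (x∉ ∷ u) = All.++⁻ˡ xs x∉ ∷ Unique-++⁻ˡ xs u

    Unique-prefix : ∀ (xs ys : List A) {zs ws} → xs ++ ys ++ zs ↭ ws → Unique ws → Unique (xs ++ ys)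
    Unique-prefix xs ys {zs} σ u =
      Unique-++⁻ˡ (xs ++ ys) (subst Unique (sym (++-assoc xs ys zs)) (Unique-resp-↭ (↭-sym σ) u))

    Unique-map-++⁺ : ∀ {B : Set} (f : A → B) xs {ys} → Unique (map f xs) → Unique (map f ys) →
      (∀ {x y} → x ∈ xs → y ∈ ys → f x ≢ f y) → Unique (map f (xs ++ ys))
    Unique-map-++⁺ f xs {ys} u v apart = subst Unique (sym (map-++ f xs ys))
      (Unique.++⁺ u v λ (fx∈ , fy∈) → separate (∈-map⁻ f fx∈) (∈-map⁻ f fy∈))
      where
      separate : ∀ {z} → ∃ (λ x → x ∈ xs × z ≡ f x) → ∃ (λ y → y ∈ ys × z ≡ f y) → ⊥
      separate (x , x∈ , refl) (y , y∈ , fx≡fy) = apart x∈ y∈ fx≡fy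

    length-cover : ∀ {B : Set} (f : B → A) ps us {xs} → map f ps ++ us ↭ xs →
      length xs ≡ length ps + length us
    length-cover f ps us {xs} σ = begin
      length xs                ≡⟨ ↭-length σ ⟨
      length (map f ps ++ us)  ≡⟨ length-++ (map f ps) ⟩
      length (map f ps) + length us ≡⟨ cong (_+ length us) (length-map f ps) ⟩
      length ps + length us    ∎
      where open ≡-Reasoning

    Unique⇒length-≤ : ∀ {xs ys : List A} → Unique xs → (∀ {x} → x ∈ xs → x ∈ ys) → length xs ≤ length ys
    Unique⇒length-≤ {[]} _ _ = z≤n
    Unique⇒length-≤ {x ∷ xs} (x∉xs ∷ u) xs⊆ys
      with pre , post , refl ← ∈-∃++ (xs⊆ys (here refl)) =
      ≤-trans (s≤s (Unique⇒length-≤ u xs⊆rest)) (≤-reflexive (sym (↭-length (shift x pre post))))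
      where
      xs⊆rest : ∀ {y} → y ∈ xs → y ∈ pre ++ post
      xs⊆rest y∈xs with ∈-resp-↭ (shift x pre post) (xs⊆ys (there y∈xs))
      ... | here refl = contradiction y∈xs (All¬⇒¬Any x∉xs)
      ... | there y∈rest = y∈rest

    Unique-map⇒lookup-injective : ∀ {B : Set} (f : A → B) (xs : List A) → Unique (map f xs) →
      ∀ i j → f (lookup xs i) ≡ f (lookup xs j) → i ≡ j
    Unique-map⇒lookup-injective f (x ∷ xs) u zero zero _ = refl
    Unique-map⇒lookup-injective f (x ∷ xs) (fx∉ ∷ _) zero (suc j) e =
      contradiction (subst (_∈ map f xs) (sym e) (∈-map⁺ f (∈-lookup j))) (All¬⇒¬Any fx∉)
    Unique-map⇒lookup-injective f (x ∷ xs) (fx∉ ∷ _) (suc i) zero e =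
      contradiction (subst (_∈ map f xs) e (∈-map⁺ f (∈-lookup i))) (All¬⇒¬Any fx∉)
    Unique-map⇒lookup-injective f (x ∷ xs) (_ ∷ u) (suc i) (suc j) e =
      cong suc (Unique-map⇒lookup-injective f xs u i j e)

  ⊓-of-sums-≤ : ∀ {d d′ e c c′} m x y → d ≤ e → d′ ≤ e → c′ ≤ c →
    (d + (c + (m + x))) ⊓ (d′ + (c′ + (m + y))) ≤ e + (c + (m + x ⊓ y))
  ⊓-of-sums-≤ {e = e} {c} m x y d≤e d′≤e c′≤c = ≤-trans
    (⊓-mono-≤ (+-mono-≤ d≤e ≤-refl) (+-mono-≤ d′≤e (+-mono-≤ c′≤c ≤-refl)))
    (≤-reflexive (begin
      (e + (c + (m + x))) ⊓ (e + (c + (m + y))) ≡⟨ +-distribˡ-⊓ e _ _ ⟨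
      e + ((c + (m + x)) ⊓ (c + (m + y)))       ≡⟨ cong (e +_) (+-distribˡ-⊓ c _ _) ⟨
      e + (c + ((m + x) ⊓ (m + y)))             ≡⟨ cong (λ k → e + (c + k)) (+-distribˡ-⊓ m x y) ⟨
      e + (c + (m + x ⊓ y))                     ∎))
    where open ≡-Reasoning

  module GreedyMatching {A B : Set} {R : A → B → Set} (R? : ∀ a b → Dec (R a b)) where

    record Matching (as : List A) (bs : List B) : Set where
      field
        pairs      : List (A × B)
        unmatchedA : List A
        unmatchedB : List B
        related    : ∀ {p} → p ∈ pairs → R (proj₁ p) (proj₂ p)
        coverA     : map proj₁ pairs ++ unmatchedA ↭ as
        coverB     : map proj₂ pairs ++ unmatchedB ↭ bs
        maximal    : ∀ {a b} → a ∈ unmatchedA → b ∈ unmatchedB → ¬ R a b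

    splitAtPartner : ∀ a bs →
      (∃₂ λ pre post → ∃ λ b → bs ≡ pre ++ b ∷ post × R a b) ⊎ (∀ {b} → b ∈ bs → ¬ R a b)
    splitAtPartner a bs with Any.any? (R? a) bs
    ... | no none = inj₂ λ b∈bs r → none (lose b∈bs r)
    ... | yes some with b , b∈bs , r ← find some with pre , post , eq ← ∈-∃++ b∈bs =
      inj₁ (pre , post , b , eq , r)

    greedy : ∀ as bs → Matching as bs
    greedy [] bs = record
      { pairs = [] ; unmatchedA = [] ; unmatchedB = bs ; related = λ ()
      ; coverA = ↭-refl ; coverB = ↭-refl ; maximal = λ () }
    greedy (a ∷ as) bs with splitAtPartner a bs
    ... | inj₁ (pre , post , b , refl , r) = record
      { pairs = (a , b) ∷ pairs ; unmatchedA = unmatchedA ; unmatchedB = unmatchedB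
      ; related = λ { (here refl) → r ; (there p∈) → related p∈ }
      ; coverA = prep a coverA
      ; coverB = ↭-trans (prep b coverB) (↭-sym (shift b pre post))
      ; maximal = maximal }
      where open Matching (greedy as (pre ++ post))
    ... | inj₂ unrelated = record
      { pairs = pairs ; unmatchedA = a ∷ unmatchedA ; unmatchedB = unmatchedB
      ; related = related
      ; coverA = ↭-trans (shift a (map proj₁ pairs) unmatchedA) (prep a coverA)
      ; coverB = coverB
      ; maximal = λ { (here refl) b∈ → unrelated (∈-resp-↭ coverB (∈-++⁺ʳ _ b∈))
                    ; (there a∈) b∈ → maximal a∈ b∈ } }
      where open Matching (greedy as bs)

  module PathsIn {n : ℕ} (Adj : Fin n → Fin n → Set) where
    open Graph Adj

    linked⇒steps : ∀ {ℓ} {xs : Vec (Fin n) (suc ℓ)} → Linked Adj xs →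
      ∀ (i : Fin ℓ) → Adj (Vec.lookup xs (inject₁ i)) (Vec.lookup xs (suc i))
    linked⇒steps {xs = _ ∷ _ ∷ _} (r ∷ _) zero = r
    linked⇒steps {xs = _ ∷ _ ∷ _} (_ ∷ rs) (suc i) = linked⇒steps rs i

    vertexPath : ∀ {ℓ} (xs : Vec (Fin n) (suc ℓ)) → Vec.Unique xs → Linked Adj xs →
      Path (Vec.lookup xs zero) (Vec.lookup xs (fromℕ ℓ))
    vertexPath {ℓ} xs distinct linked = record
      { len = ℓ ; vert = Vec.lookup xs ; inj = lookup-injective distinct
      ; start = refl ; end = refl ; adj = linked⇒steps linked }

    chain⇒reachable : ∀ {R} m (f : Fin (suc m) → Fin n) →
      (∀ i → R (f (inject₁ i)) (f (suc i))) → Reachable R (f zero) (f (fromℕ m))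
    chain⇒reachable zero    f steps = here
    chain⇒reachable (suc m) f steps = step (steps zero) (chain⇒reachable m (f ∘ suc) (steps ∘ suc))

  module EdgeCuts {n : ℕ} {Adj : Fin n → Fin n → Set} (Adj? : Decidable Adj) where
    open Graph Adj
    open Path
    open PathsIn Adj using (chain⇒reachable)

    EdgeDisjointPaths : ℕ → Fin n → Fin n → Set
    EdgeDisjointPaths m v w =
      Σ (Fin m → Path v w) λ ps → ∀ i j → i ≢ j → EdgeDisjoint (ps i) (ps j)

    hasDegree : ∀ v → HasDegree v (length (filter (Adj? v) (allFin n)))
    hasDegree v = filter (Adj? v) (allFin n) , Unique.filter⁺ (Adj? v) (Unique.allFin⁺ n) , refl ,
      λ w → mk⇔ (proj₂ ∘ ∈-filter⁻ (Adj? v) {xs = allFin n}) (∈-filter⁺ (Adj? v) (∈-allFin w))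

    HitsEdgeOf : ∀ {v w} → List (Fin n × Fin n) → Path v w → Set
    HitsEdgeOf F p = Any.Any (λ e → UsesEdge p (proj₁ e) (proj₂ e)) F

    hitsEdgeOf? : ∀ {v w} F (p : Path v w) → Dec (HitsEdgeOf F p)
    hitsEdgeOf? F p = Any.any? (λ e → usesEdge? (proj₁ e) (proj₂ e)) F
      where
      usesEdge? : ∀ x y → Dec (UsesEdge p x y)
      usesEdge? x y = any? λ i → ((vert p (inject₁ i) ≟ x) ×-dec (vert p (suc i) ≟ y)) ⊎-dec
                                 ((vert p (inject₁ i) ≟ y) ×-dec (vert p (suc i) ≟ x))

    path⇒reachable : ∀ {v w} F (p : Path v w) → ¬ HitsEdgeOf F p → Reachable (Delete F) v w
    path⇒reachable F p miss = subst₂ (Reachable (Delete F)) (start p) (end p)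
      (chain⇒reachable (len p) (vert p) λ i →
        adj p i , (λ e∈F → miss (lose e∈F (i , inj₁ (refl , refl))))
                , (λ e∈F → miss (lose e∈F (i , inj₂ (refl , refl)))))

    disjointPaths⇒reachable : ∀ {m v w} F → length F < m → EdgeDisjointPaths m v w →
      Reachable (Delete F) v w
    disjointPaths⇒reachable F |F|<m (ps , disjoint) with any? (λ i → ¬? (hitsEdgeOf? F (ps i)))
    ... | yes (i , miss) = path⇒reachable F (ps i) miss
    ... | no allHit = contradiction (pigeonhole |F|<m (Any.index ∘ hit)) shareNoEdge
      where
      hit : ∀ i → HitsEdgeOf F (ps i)
      hit i = decidable-stable (hitsEdgeOf? F (ps i)) (λ miss → allHit (i , miss))
      shareNoEdge : ¬ ∃₂ λ i j → i Fin.< j × Any.index (hit i) ≡ Any.index (hit j)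
      shareNoEdge (i , j , i<j , same) = disjoint i j (λ { refl → <-irrefl refl i<j }) _ _
        (lookup-index (hit i))
        (subst (λ k → UsesEdge (ps j) (proj₁ (lookup F k)) (proj₂ (lookup F k))) (sym same)
          (lookup-index (hit j)))

    isolatingCut : ∀ {v d} → HasDegree v d → ∃[ u ] u ≢ v →
      ∃[ F ] (length F ≡ d × (∀ e → e ∈ F → Adj (proj₁ e) (proj₂ e)) × ¬ Connected (Delete F))
    isolatingCut {v} (ns , _ , |ns|≡d , nbrs) (u , u≢v) =
      map (v ,_) ns , trans (length-map (v ,_) ns) |ns|≡d , incident , λ conn → u≢v (stuck (conn v u) refl)
      where
      incident : ∀ e → e ∈ map (v ,_) ns → Adj (proj₁ e) (proj₂ e)
      incident e e∈ with _ , x∈ns , refl ← ∈-map⁻ (v ,_) e∈ = Equivalence.to (nbrs _) x∈ns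
      stuck : ∀ {x y} → Reachable (Delete (map (v ,_) ns)) x y → x ≡ v → y ≡ v
      stuck here x≡v = x≡v
      stuck (step (vx , vx∉F , _) _) refl = contradiction (∈-map⁺ (v ,_) (Equivalence.from (nbrs _) vx)) vx∉F

    minDegree⇒edgeConnectivity : (∃[ a ] ∃[ b ] a ≢ b) →
      (∀ a b → a ≢ b → ∀ {da db} → HasDegree a da → HasDegree b db →
        EdgeDisjointPaths (da ⊓ db) a b) →
      ∀ δ → MinDegree δ → EdgeConnectivity δ
    minDegree⇒edgeConnectivity (a , b , a≢b) paths δ ((v , degv) , minimal) =
      connected , isolatingCut degv other
      where
      connected : ∀ F → length F < δ → Connected (Delete F)
      connected F |F|<δ x y with x ≟ y
      ... | yes refl = here
      ... | no x≢y = disjointPaths⇒reachable F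
        (<-≤-trans |F|<δ (⊓-glb (minimal x _ (hasDegree x)) (minimal y _ (hasDegree y))))
        (paths x y x≢y (hasDegree x) (hasDegree y))
      other : ∃[ u ] u ≢ v
      other with a ≟ v
      ... | yes refl = b , a≢b ∘ sym
      ... | no a≢v = a , a≢v

  module DiameterTwo {n : ℕ} {Adj : Fin n → Fin n → Set} (Adj? : Decidable Adj)
    (Adj-sym : Symmetric Adj) (Adj-irrefl : ∀ {x} → ¬ Adj x x)
    (commonNeighbour : ∀ a b → a ≢ b → ¬ Adj a b → ∃[ c ] (Adj a c × Adj c b)) where

    open Graph Adj
    open PathsIn Adj using (vertexPath)
    open GreedyMatching Adj? using (Matching; greedy)

    adj⇒≢ : ∀ {x y} → Adj x y → x ≢ y
    adj⇒≢ xy refl = Adj-irrefl xy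

    ShortEdgeDisjointPaths : ℕ → Fin n → Fin n → Set
    ShortEdgeDisjointPaths m v w = Σ (Fin m → Path v w) λ ps →
      (∀ i → Path.len (ps i) ≤ 4) × (∀ i j → i ≢ j → EdgeDisjoint (ps i) (ps j))

    record Bridge : Set where
      constructor bridge
      field left mid right : Fin n
    open Bridge

    record Bridging (as bs : List (Fin n)) : Set where
      field
        bridges : List Bridge
        spareA spareB : List (Fin n)
        coverA : map left bridges ++ spareA ↭ as
        coverB : map right bridges ++ spareB ↭ bs
        count  : length bridges ≡ length as ⊓ length bs
        linked : ∀ {t} → t ∈ bridges → Adj (left t) (mid t) × Adj (mid t) (right t)

    bridging : ∀ as bs → (∀ {a b} → a ∈ as → b ∈ bs → a ≢ b × ¬ Adj a b) → Bridging as bs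
    bridging [] bs _ = record
      { bridges = [] ; spareA = [] ; spareB = bs
      ; coverA = ↭-refl ; coverB = ↭-refl ; count = refl ; linked = λ () }
    bridging (a ∷ as) [] _ = record
      { bridges = [] ; spareA = a ∷ as ; spareB = []
      ; coverA = ↭-refl ; coverB = ↭-refl ; count = refl ; linked = λ () }
    bridging (a ∷ as) (b ∷ bs) apart =
      extend (commonNeighbour a b (proj₁ apartₐᵦ) (proj₂ apartₐᵦ))
             (bridging as bs λ a∈ b∈ → apart (there a∈) (there b∈))
      where
      apartₐᵦ = apart (here refl) (here refl)
      extend : ∃[ c ] (Adj a c × Adj c b) → Bridging as bs → Bridging (a ∷ as) (b ∷ bs)
      extend (c , ac , cb) rest = record
        { bridges = bridge a c b ∷ bridges ; spareA = spareA ; spareB = spareB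
        ; coverA = prep a coverA ; coverB = prep b coverB ; count = cong suc count
        ; linked = λ { (here refl) → ac , cb ; (there t∈) → linked t∈ } }
        where open Bridging rest

    module NeighbourSplit (ns : List (Fin n)) (x : Fin n) where

      equal others shared exclusive : List (Fin n)
      equal     = filter (_≟ x) ns
      others    = filter (∁? (_≟ x)) ns
      shared    = filter (Adj? x) others
      exclusive = filter (∁? (Adj? x)) others

      split : equal ++ shared ++ exclusive ↭ ns
      split = ↭-trans (++⁺ˡ equal (filter-∁-↭ (Adj? x) others)) (filter-∁-↭ (_≟ x) ns)

      size : length ns ≡ length equal + (length shared + length exclusive)
      size = begin
        length ns                                      ≡⟨ ↭-length split ⟨
        length (equal ++ shared ++ exclusive)          ≡⟨ length-++ equal ⟩
        length equal + length (shared ++ exclusive)    ≡⟨ cong (length equal +_) (length-++ shared) ⟩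
        length equal + (length shared + length exclusive) ∎
        where open ≡-Reasoning

      equal⇒ : ∀ {y} → y ∈ equal → y ∈ ns × y ≡ x
      equal⇒ = ∈-filter⁻ (_≟ x) {xs = ns}

      shared⇒ : ∀ {y} → y ∈ shared → y ∈ ns × y ≢ x × Adj x y
      shared⇒ y∈ with y∈others , xy ← ∈-filter⁻ (Adj? x) {xs = others} y∈
                     with y∈ns , y≢x ← ∈-filter⁻ (∁? (_≟ x)) {xs = ns} y∈others = y∈ns , y≢x , xy

      exclusive⇒ : ∀ {y} → y ∈ exclusive → y ∈ ns × y ≢ x × ¬ Adj x y
      exclusive⇒ y∈ with y∈others , ¬xy ← ∈-filter⁻ (∁? (Adj? x)) {xs = others} y∈
                        with y∈ns , y≢x ← ∈-filter⁻ (∁? (_≟ x)) {xs = ns} y∈others = y∈ns , y≢x , ¬xy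

      shared⇐ : ∀ {y} → y ∈ ns → y ≢ x → Adj x y → y ∈ shared
      shared⇐ y∈ y≢x xy = ∈-filter⁺ (Adj? x) (∈-filter⁺ (∁? (_≟ x)) y∈ y≢x) xy

      module _ (distinct : Unique ns) where
        equal-distinct : Unique equal
        equal-distinct = Unique.filter⁺ (_≟ x) distinct
        others-distinct : Unique others
        others-distinct = Unique.filter⁺ (∁? (_≟ x)) distinct
        shared-distinct : Unique shared
        shared-distinct = Unique.filter⁺ (Adj? x) others-distinct
        exclusive-distinct : Unique exclusive
        exclusive-distinct = Unique.filter⁺ (∁? (Adj? x)) others-distinct

    module Between (v w : Fin n) (v≢w : v ≢ w) where

      data Route : Set where
        direct : Route
        via₁   : Fin n → Route
        via₂   : Fin n → Fin n → Route
        via₃   : Fin n → Fin n → Fin n → Route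

      second penultimate : Route → Fin n
      second direct        = w
      second (via₁ x)      = x
      second (via₂ a b)    = a
      second (via₃ a c b)  = a
      penultimate direct       = v
      penultimate (via₁ x)     = x
      penultimate (via₂ a b)   = b
      penultimate (via₃ a c b) = b

      PrivateV PrivateW : Fin n → Set
      PrivateV a = Adj v a × ¬ Adj w a × a ≢ w
      PrivateW b = Adj w b × ¬ Adj v b × b ≢ v

      Admissible : Route → Set
      Admissible direct       = Adj v w
      Admissible (via₁ x)     = Adj v x × Adj x w
      Admissible (via₂ a b)   = PrivateV a × PrivateW b × Adj a b
      Admissible (via₃ a c b) = PrivateV a × PrivateW b × Adj a c × Adj c b

      toPath : ∀ r → Admissible r → Path v w
      toPath direct vw = vertexPath (v ∷ w ∷ []) ((v≢w ∷ []) ∷ [] ∷ []) (vw ∷ [-])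
      toPath (via₁ x) (vx , xw) = vertexPath (v ∷ x ∷ w ∷ [])
        ((adj⇒≢ vx ∷ v≢w ∷ []) ∷ (adj⇒≢ xw ∷ []) ∷ [] ∷ [])
        (vx ∷ xw ∷ [-])
      toPath (via₂ a b) ((va , _ , a≢w) , (wb , _ , b≢v) , ab) = vertexPath (v ∷ a ∷ b ∷ w ∷ [])
        ((adj⇒≢ va ∷ b≢v ∘ sym ∷ v≢w ∷ []) ∷ (adj⇒≢ ab ∷ a≢w ∷ []) ∷ (adj⇒≢ bw ∷ []) ∷ [] ∷ [])
        (va ∷ ab ∷ bw ∷ [-])
        where bw = Adj-sym wb
      toPath (via₃ a c b) ((va , ¬wa , a≢w) , (wb , ¬vb , b≢v) , ac , cb) =
        vertexPath (v ∷ a ∷ c ∷ b ∷ w ∷ [])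
          ((adj⇒≢ va ∷ (λ { refl → ¬vb cb }) ∷ b≢v ∘ sym ∷ v≢w ∷ [])
          ∷ (adj⇒≢ ac ∷ (λ { refl → ¬vb va }) ∷ a≢w ∷ [])
          ∷ (adj⇒≢ cb ∷ (λ { refl → ¬wa (Adj-sym ac) }) ∷ [])
          ∷ (adj⇒≢ bw ∷ []) ∷ [] ∷ [])
          (va ∷ ac ∷ cb ∷ bw ∷ [-])
        where bw = Adj-sym wb

      toPath-len≤4 : ∀ r (ok : Admissible r) → Path.len (toPath r ok) ≤ 4
      toPath-len≤4 direct       _ = m≤m+n 1 3
      toPath-len≤4 (via₁ _)     _ = m≤m+n 2 2
      toPath-len≤4 (via₂ _ _)   _ = m≤m+n 3 1
      toPath-len≤4 (via₃ _ _ _) _ = ≤-refl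

      data Step : Route → Fin n → Fin n → Set where
        direct-vw : Step direct v w
        via₁-vx : ∀ {x} → Step (via₁ x) v x
        via₁-xw : ∀ {x} → Step (via₁ x) x w
        via₂-va : ∀ {a b} → Step (via₂ a b) v a
        via₂-ab : ∀ {a b} → Step (via₂ a b) a b
        via₂-bw : ∀ {a b} → Step (via₂ a b) b w
        via₃-va : ∀ {a c b} → Step (via₃ a c b) v a
        via₃-ac : ∀ {a c b} → Step (via₃ a c b) a c
        via₃-cb : ∀ {a c b} → Step (via₃ a c b) c b
        via₃-bw : ∀ {a c b} → Step (via₃ a c b) b w

      Link : Route → Fin n → Fin n → Set
      Link r x y = Step r x y ⊎ Step r y x

      uses⇒link : ∀ r (ok : Admissible r) {x y} → UsesEdge (toPath r ok) x y → Link r x y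
      uses⇒link direct       _ (zero , inj₁ (refl , refl))             = inj₁ direct-vw
      uses⇒link direct       _ (zero , inj₂ (refl , refl))             = inj₂ direct-vw
      uses⇒link (via₁ _)     _ (zero , inj₁ (refl , refl))             = inj₁ via₁-vx
      uses⇒link (via₁ _)     _ (zero , inj₂ (refl , refl))             = inj₂ via₁-vx
      uses⇒link (via₁ _)     _ (suc zero , inj₁ (refl , refl))         = inj₁ via₁-xw
      uses⇒link (via₁ _)     _ (suc zero , inj₂ (refl , refl))         = inj₂ via₁-xw
      uses⇒link (via₂ _ _)   _ (zero , inj₁ (refl , refl))             = inj₁ via₂-va
      uses⇒link (via₂ _ _)   _ (zero , inj₂ (refl , refl))             = inj₂ via₂-va
      uses⇒link (via₂ _ _)   _ (suc zero , inj₁ (refl , refl))         = inj₁ via₂-ab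
      uses⇒link (via₂ _ _)   _ (suc zero , inj₂ (refl , refl))         = inj₂ via₂-ab
      uses⇒link (via₂ _ _)   _ (suc (suc zero) , inj₁ (refl , refl))   = inj₁ via₂-bw
      uses⇒link (via₂ _ _)   _ (suc (suc zero) , inj₂ (refl , refl))   = inj₂ via₂-bw
      uses⇒link (via₃ _ _ _) _ (zero , inj₁ (refl , refl))             = inj₁ via₃-va
      uses⇒link (via₃ _ _ _) _ (zero , inj₂ (refl , refl))             = inj₂ via₃-va
      uses⇒link (via₃ _ _ _) _ (suc zero , inj₁ (refl , refl))         = inj₁ via₃-ac
      uses⇒link (via₃ _ _ _) _ (suc zero , inj₂ (refl , refl))         = inj₂ via₃-ac
      uses⇒link (via₃ _ _ _) _ (suc (suc zero) , inj₁ (refl , refl))   = inj₁ via₃-cb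
      uses⇒link (via₃ _ _ _) _ (suc (suc zero) , inj₂ (refl , refl))   = inj₂ via₃-cb
      uses⇒link (via₃ _ _ _) _ (suc (suc (suc zero)) , inj₁ (refl , refl)) = inj₁ via₃-bw
      uses⇒link (via₃ _ _ _) _ (suc (suc (suc zero)) , inj₂ (refl , refl)) = inj₂ via₃-bw

      link-at-v : ∀ {r x y} → Admissible r → Link r x y → x ≡ v → y ≡ second r
      link-at-v _ (inj₁ direct-vw) _ = refl
      link-at-v _ (inj₂ direct-vw) w≡v = contradiction (sym w≡v) v≢w
      link-at-v _ (inj₁ via₁-vx) _ = refl
      link-at-v (vx , _) (inj₁ via₁-xw) refl = ⊥-elim (Adj-irrefl vx)
      link-at-v (vx , _) (inj₂ via₁-vx) refl = ⊥-elim (Adj-irrefl vx)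
      link-at-v _ (inj₂ via₁-xw) w≡v = contradiction (sym w≡v) v≢w
      link-at-v _ (inj₁ via₂-va) _ = refl
      link-at-v ((va , _) , _) (inj₁ via₂-ab) refl = ⊥-elim (Adj-irrefl va)
      link-at-v (_ , (_ , _ , b≢v) , _) (inj₁ via₂-bw) b≡v = contradiction b≡v b≢v
      link-at-v ((va , _) , _) (inj₂ via₂-va) refl = ⊥-elim (Adj-irrefl va)
      link-at-v (_ , (_ , _ , b≢v) , _) (inj₂ via₂-ab) b≡v = contradiction b≡v b≢v
      link-at-v _ (inj₂ via₂-bw) w≡v = contradiction (sym w≡v) v≢w
      link-at-v _ (inj₁ via₃-va) _ = refl
      link-at-v ((va , _) , _) (inj₁ via₃-ac) refl = ⊥-elim (Adj-irrefl va)
      link-at-v (_ , (_ , ¬vb , _) , _ , cb) (inj₁ via₃-cb) refl = ⊥-elim (¬vb cb)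
      link-at-v (_ , (_ , _ , b≢v) , _) (inj₁ via₃-bw) b≡v = contradiction b≡v b≢v
      link-at-v ((va , _) , _) (inj₂ via₃-va) refl = ⊥-elim (Adj-irrefl va)
      link-at-v (_ , (_ , ¬vb , _) , _ , cb) (inj₂ via₃-ac) refl = ⊥-elim (¬vb cb)
      link-at-v (_ , (_ , _ , b≢v) , _) (inj₂ via₃-cb) b≡v = contradiction b≡v b≢v
      link-at-v _ (inj₂ via₃-bw) w≡v = contradiction (sym w≡v) v≢w

      link-at-w : ∀ {r x y} → Admissible r → Link r x y → x ≡ w → y ≡ penultimate r
      link-at-w _ (inj₁ direct-vw) v≡w = contradiction v≡w v≢w
      link-at-w _ (inj₂ direct-vw) _ = refl
      link-at-w _ (inj₁ via₁-vx) v≡w = contradiction v≡w v≢w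
      link-at-w (_ , xw) (inj₁ via₁-xw) refl = ⊥-elim (Adj-irrefl xw)
      link-at-w (_ , xw) (inj₂ via₁-vx) refl = ⊥-elim (Adj-irrefl xw)
      link-at-w _ (inj₂ via₁-xw) _ = refl
      link-at-w _ (inj₁ via₂-va) v≡w = contradiction v≡w v≢w
      link-at-w ((_ , _ , a≢w) , _) (inj₁ via₂-ab) a≡w = contradiction a≡w a≢w
      link-at-w (_ , (wb , _) , _) (inj₁ via₂-bw) refl = ⊥-elim (Adj-irrefl wb)
      link-at-w ((_ , _ , a≢w) , _) (inj₂ via₂-va) a≡w = contradiction a≡w a≢w
      link-at-w (_ , (wb , _) , _) (inj₂ via₂-ab) refl = ⊥-elim (Adj-irrefl wb)
      link-at-w _ (inj₂ via₂-bw) _ = refl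
      link-at-w _ (inj₁ via₃-va) v≡w = contradiction v≡w v≢w
      link-at-w ((_ , _ , a≢w) , _) (inj₁ via₃-ac) a≡w = contradiction a≡w a≢w
      link-at-w ((_ , ¬wa , _) , _ , ac , _) (inj₁ via₃-cb) refl = ⊥-elim (¬wa (Adj-sym ac))
      link-at-w (_ , (wb , _) , _) (inj₁ via₃-bw) refl = ⊥-elim (Adj-irrefl wb)
      link-at-w ((_ , _ , a≢w) , _) (inj₂ via₃-va) a≡w = contradiction a≡w a≢w
      link-at-w ((_ , ¬wa , _) , _ , ac , _) (inj₂ via₃-ac) refl = ⊥-elim (¬wa (Adj-sym ac))
      link-at-w (_ , (wb , _) , _) (inj₂ via₃-cb) refl = ⊥-elim (Adj-irrefl wb)
      link-at-w _ (inj₂ via₃-bw) _ = refl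

      data Inner : Route → Fin n → Fin n → Set where
        via₂-ab : ∀ {a b} → Inner (via₂ a b) a b
        via₃-ac : ∀ {a c b} → Inner (via₃ a c b) a c
        via₃-cb : ∀ {a c b} → Inner (via₃ a c b) c b

      link⇒inner : ∀ {r x y} → Link r x y → x ≢ v → y ≢ v → x ≢ w → y ≢ w →
        Inner r x y ⊎ Inner r y x
      link⇒inner (inj₁ direct-vw) x≢v _ _ _ = contradiction refl x≢v
      link⇒inner (inj₂ direct-vw) _ y≢v _ _ = contradiction refl y≢v
      link⇒inner (inj₁ via₁-vx) x≢v _ _ _ = contradiction refl x≢v
      link⇒inner (inj₁ via₁-xw) _ _ _ y≢w = contradiction refl y≢w
      link⇒inner (inj₂ via₁-vx) _ y≢v _ _ = contradiction refl y≢v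
      link⇒inner (inj₂ via₁-xw) _ _ x≢w _ = contradiction refl x≢w
      link⇒inner (inj₁ via₂-va) x≢v _ _ _ = contradiction refl x≢v
      link⇒inner (inj₁ via₂-ab) _ _ _ _ = inj₁ via₂-ab
      link⇒inner (inj₁ via₂-bw) _ _ _ y≢w = contradiction refl y≢w
      link⇒inner (inj₂ via₂-va) _ y≢v _ _ = contradiction refl y≢v
      link⇒inner (inj₂ via₂-ab) _ _ _ _ = inj₂ via₂-ab
      link⇒inner (inj₂ via₂-bw) _ _ x≢w _ = contradiction refl x≢w
      link⇒inner (inj₁ via₃-va) x≢v _ _ _ = contradiction refl x≢v
      link⇒inner (inj₁ via₃-ac) _ _ _ _ = inj₁ via₃-ac
      link⇒inner (inj₁ via₃-cb) _ _ _ _ = inj₁ via₃-cb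
      link⇒inner (inj₁ via₃-bw) _ _ _ y≢w = contradiction refl y≢w
      link⇒inner (inj₂ via₃-va) _ y≢v _ _ = contradiction refl y≢v
      link⇒inner (inj₂ via₃-ac) _ _ _ _ = inj₂ via₃-ac
      link⇒inner (inj₂ via₃-cb) _ _ _ _ = inj₂ via₃-cb
      link⇒inner (inj₂ via₃-bw) _ _ x≢w _ = contradiction refl x≢w

      Separated : Route → Route → Set
      Separated (via₃ _ c _) (via₃ a′ _ b′) = c ≢ a′ × c ≢ b′
      Separated _ _ = ⊤

      SameEnd : Route → Route → Set
      SameEnd r r′ = second r ≡ second r′ ⊎ penultimate r ≡ penultimate r′

      -- Every contradiction below is a vertex that would be a neighbour of v (as a second vertex)
      -- and a non-neighbour of v (as a penultimate vertex), or one excluded by separation.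
      inner⇒sameEnd : ∀ {r r′ x y} → Admissible r → Admissible r′ → Separated r r′ → Separated r′ r →
        Inner r x y → Inner r′ x y ⊎ Inner r′ y x → SameEnd r r′
      inner⇒sameEnd _ _ _ _ via₂-ab (inj₁ via₂-ab) = inj₁ refl
      inner⇒sameEnd ((va , _) , _) (_ , (_ , ¬va , _) , _) _ _ via₂-ab (inj₂ via₂-ab) = ⊥-elim (¬va va)
      inner⇒sameEnd _ _ _ _ via₂-ab (inj₁ via₃-ac) = inj₁ refl
      inner⇒sameEnd (_ , (_ , ¬vb , _) , _) ((vb , _) , _) _ _ via₂-ab (inj₂ via₃-ac) = ⊥-elim (¬vb vb)
      inner⇒sameEnd _ _ _ _ via₂-ab (inj₁ via₃-cb) = inj₂ refl
      inner⇒sameEnd ((va , _) , _) (_ , (_ , ¬va , _) , _) _ _ via₂-ab (inj₂ via₃-cb) = ⊥-elim (¬va va)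
      inner⇒sameEnd _ _ _ _ via₃-ac (inj₁ via₂-ab) = inj₁ refl
      inner⇒sameEnd ((va , _) , _) (_ , (_ , ¬va , _) , _) _ _ via₃-ac (inj₂ via₂-ab) = ⊥-elim (¬va va)
      inner⇒sameEnd _ _ _ _ via₃-ac (inj₁ via₃-ac) = inj₁ refl
      inner⇒sameEnd _ _ (c≢a′ , _) _ via₃-ac (inj₂ via₃-ac) = contradiction refl c≢a′
      inner⇒sameEnd _ _ _ (c′≢a , _) via₃-ac (inj₁ via₃-cb) = contradiction refl c′≢a
      inner⇒sameEnd ((va , _) , _) (_ , (_ , ¬va , _) , _) _ _ via₃-ac (inj₂ via₃-cb) = ⊥-elim (¬va va)
      inner⇒sameEnd _ _ _ _ via₃-cb (inj₁ via₂-ab) = inj₂ refl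
      inner⇒sameEnd (_ , (_ , ¬vb , _) , _) ((vb , _) , _) _ _ via₃-cb (inj₂ via₂-ab) = ⊥-elim (¬vb vb)
      inner⇒sameEnd _ _ (c≢a′ , _) _ via₃-cb (inj₁ via₃-ac) = contradiction refl c≢a′
      inner⇒sameEnd (_ , (_ , ¬vb , _) , _) ((vb , _) , _) _ _ via₃-cb (inj₂ via₃-ac) = ⊥-elim (¬vb vb)
      inner⇒sameEnd _ _ _ _ via₃-cb (inj₁ via₃-cb) = inj₂ refl
      inner⇒sameEnd _ _ (_ , c≢b′) _ via₃-cb (inj₂ via₃-cb) = contradiction refl c≢b′

      link⇒sameEnd : ∀ {r r′ x y} → Admissible r → Admissible r′ → Separated r r′ → Separated r′ r →
        Link r x y → Link r′ x y → SameEnd r r′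
      link⇒sameEnd {x = x} {y} ok ok′ sep sep′ l l′ with x ≟ v | y ≟ v | x ≟ w | y ≟ w
      ... | yes x≡v | _ | _ | _ = inj₁ (trans (sym (link-at-v ok l x≡v)) (link-at-v ok′ l′ x≡v))
      ... | no _ | yes y≡v | _ | _ =
        inj₁ (trans (sym (link-at-v ok (swap l) y≡v)) (link-at-v ok′ (swap l′) y≡v))
      ... | no _ | no _ | yes x≡w | _ = inj₂ (trans (sym (link-at-w ok l x≡w)) (link-at-w ok′ l′ x≡w))
      ... | no _ | no _ | no _ | yes y≡w =
        inj₂ (trans (sym (link-at-w ok (swap l) y≡w)) (link-at-w ok′ (swap l′) y≡w))
      ... | no x≢v | no y≢v | no x≢w | no y≢w with link⇒inner l x≢v y≢v x≢w y≢w
      ...   | inj₁ i = inner⇒sameEnd ok ok′ sep sep′ i (link⇒inner l′ x≢v y≢v x≢w y≢w)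
      ...   | inj₂ i = inner⇒sameEnd ok ok′ sep sep′ i (swap (link⇒inner l′ x≢v y≢v x≢w y≢w))

      routePaths : (rs : List Route) → All Admissible rs →
        (∀ {r r′} → r ∈ rs → r′ ∈ rs → Separated r r′) →
        Unique (map second rs) → Unique (map penultimate rs) →
        ∀ m → m ≤ length rs → ShortEdgeDisjointPaths m v w
      routePaths rs admissible separated seconds-distinct penultimates-distinct m m≤ =
        paths , (λ i → toPath-len≤4 (route i) (ok i)) , disjoint
        where
        index : Fin m → Fin (length rs)
        index i = inject≤ i m≤
        route : Fin m → Route
        route i = lookup rs (index i)
        ok : ∀ i → Admissible (route i)
        ok i = All.lookup admissible (∈-lookup (index i))
        paths : Fin m → Path v w
        paths i = toPath (route i) (ok i)
        sep : ∀ i j → Separated (route i) (route j)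
        sep i j = separated (∈-lookup (index i)) (∈-lookup (index j))
        disjoint : ∀ i j → i ≢ j → EdgeDisjoint (paths i) (paths j)
        disjoint i j i≢j x y uᵢ uⱼ
          with link⇒sameEnd (ok i) (ok j) (sep i j) (sep j i)
                 (uses⇒link (route i) (ok i) uᵢ) (uses⇒link (route j) (ok j) uⱼ)
        ... | inj₁ same = i≢j (inject≤-injective m≤ m≤ i j
                (Unique-map⇒lookup-injective second rs seconds-distinct (index i) (index j) same))
        ... | inj₂ same = i≢j (inject≤-injective m≤ m≤ i j
                (Unique-map⇒lookup-injective penultimate rs penultimates-distinct (index i) (index j) same))

      directRoutes : Dec (Adj v w) → List Route
      directRoutes (yes _) = [ direct ]
      directRoutes (no _)  = []

      pairRoute : Fin n × Fin n → Route
      pairRoute p = via₂ (proj₁ p) (proj₂ p)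

      bridgeRoute : Bridge → Route
      bridgeRoute t = via₃ (left t) (mid t) (right t)

      module Routes {dv dw} (degV : HasDegree v dv) (degW : HasDegree w dw) where

        module V = NeighbourSplit (proj₁ degV) w
        module W = NeighbourSplit (proj₁ degW) v

        nbrV : ∀ {x} → x ∈ proj₁ degV → Adj v x
        nbrV = Equivalence.to (proj₂ (proj₂ (proj₂ degV)) _)

        nbrV⁻¹ : ∀ {x} → Adj v x → x ∈ proj₁ degV
        nbrV⁻¹ = Equivalence.from (proj₂ (proj₂ (proj₂ degV)) _)

        nbrW : ∀ {x} → x ∈ proj₁ degW → Adj w x
        nbrW = Equivalence.to (proj₂ (proj₂ (proj₂ degW)) _)

        privateV : ∀ {a} → a ∈ V.exclusive → PrivateV a
        privateV a∈ with a∈ns , a≢w , ¬wa ← V.exclusive⇒ a∈ = nbrV a∈ns , ¬wa , a≢w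

        privateW : ∀ {b} → b ∈ W.exclusive → PrivateW b
        privateW b∈ with b∈ns , b≢v , ¬vb ← W.exclusive⇒ b∈ = nbrW b∈ns , ¬vb , b≢v

        matching : Matching V.exclusive W.exclusive
        matching = greedy V.exclusive W.exclusive
        module M = Matching matching

        unmatchedA⊆ : ∀ {a} → a ∈ M.unmatchedA → a ∈ V.exclusive
        unmatchedA⊆ a∈ = ∈-resp-↭ M.coverA (∈-++⁺ʳ _ a∈)

        unmatchedB⊆ : ∀ {b} → b ∈ M.unmatchedB → b ∈ W.exclusive
        unmatchedB⊆ b∈ = ∈-resp-↭ M.coverB (∈-++⁺ʳ _ b∈)

        apart : ∀ {a b} → a ∈ M.unmatchedA → b ∈ M.unmatchedB → a ≢ b × ¬ Adj a b
        apart a∈ b∈ =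
          (λ { refl → proj₁ (proj₂ (privateW (unmatchedB⊆ b∈))) (proj₁ (privateV (unmatchedA⊆ a∈))) }) ,
          M.maximal a∈ b∈

        bridged : Bridging M.unmatchedA M.unmatchedB
        bridged = bridging M.unmatchedA M.unmatchedB apart
        module T = Bridging bridged

        longRoutes : List Route
        longRoutes = map pairRoute M.pairs ++ map bridgeRoute T.bridges

        directs : List Route
        directs = directRoutes (Adj? v w)

        routes : List Route
        routes = directs ++ map via₁ V.shared ++ longRoutes

        map-longRoutes : ∀ (f : Route → Fin n) →
          map f longRoutes ≡ map (f ∘ pairRoute) M.pairs ++ map (f ∘ bridgeRoute) T.bridges
        map-longRoutes f =
          trans (map-++ f (map pairRoute M.pairs) _)
                (cong₂ _++_ (sym (map-∘ M.pairs)) (sym (map-∘ T.bridges)))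

        pair-ends : ∀ {p} → p ∈ M.pairs → proj₁ p ∈ V.exclusive × proj₂ p ∈ W.exclusive
        pair-ends p∈ =
          ∈-resp-↭ M.coverA (∈-++⁺ˡ (∈-map⁺ proj₁ p∈)) , ∈-resp-↭ M.coverB (∈-++⁺ˡ (∈-map⁺ proj₂ p∈))

        bridge-ends : ∀ {t} → t ∈ T.bridges → left t ∈ M.unmatchedA × right t ∈ M.unmatchedB
        bridge-ends t∈ =
          ∈-resp-↭ T.coverA (∈-++⁺ˡ (∈-map⁺ left t∈)) , ∈-resp-↭ T.coverB (∈-++⁺ˡ (∈-map⁺ right t∈))

        long-ends : ∀ {r} → r ∈ longRoutes → second r ∈ V.exclusive × penultimate r ∈ W.exclusive
        long-ends r∈ with ∈-++⁻ (map pairRoute M.pairs) r∈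
        ... | inj₁ r∈pairs with p , p∈ , refl ← ∈-map⁻ pairRoute r∈pairs = pair-ends p∈
        ... | inj₂ r∈bridges with t , t∈ , refl ← ∈-map⁻ bridgeRoute r∈bridges =
          unmatchedA⊆ (proj₁ (bridge-ends t∈)) , unmatchedB⊆ (proj₂ (bridge-ends t∈))

        data Origin : Route → Set where
          fromDirect : Adj v w → Origin direct
          fromCommon : ∀ {x} → x ∈ V.shared → Origin (via₁ x)
          fromPair   : ∀ {a b} → (a , b) ∈ M.pairs → Origin (via₂ a b)
          fromBridge : ∀ {a c b} → bridge a c b ∈ T.bridges → Origin (via₃ a c b)

        origin : ∀ {r} → r ∈ routes → Origin r
        origin r∈ with ∈-++⁻ directs r∈
        ... | inj₁ r∈direct = fromDirectRoutes (Adj? v w) r∈direct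
          where
          fromDirectRoutes : ∀ d {r} → r ∈ directRoutes d → Origin r
          fromDirectRoutes (yes vw) (here refl) = fromDirect vw
        ... | inj₂ r∈ with ∈-++⁻ (map via₁ V.shared) r∈
        ...   | inj₁ r∈common with x , x∈ , refl ← ∈-map⁻ via₁ r∈common = fromCommon x∈
        ...   | inj₂ r∈ with ∈-++⁻ (map pairRoute M.pairs) r∈
        ...     | inj₁ r∈pairs with p , p∈ , refl ← ∈-map⁻ pairRoute r∈pairs = fromPair p∈
        ...     | inj₂ r∈bridges with t , t∈ , refl ← ∈-map⁻ bridgeRoute r∈bridges = fromBridge t∈

        admissible : ∀ {r} → Origin r → Admissible r
        admissible (fromDirect vw) = vw
        admissible (fromCommon x∈) with x∈ns , _ , wx ← V.shared⇒ x∈ = nbrV x∈ns , Adj-sym wx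
        admissible (fromPair p∈) =
          privateV (proj₁ (pair-ends p∈)) , privateW (proj₂ (pair-ends p∈)) , M.related p∈
        admissible (fromBridge t∈) =
          privateV (unmatchedA⊆ (proj₁ (bridge-ends t∈))) ,
          privateW (unmatchedB⊆ (proj₂ (bridge-ends t∈))) , T.linked t∈

        -- The middle vertex of a bridge is adjacent to an unmatched vertex on each side,
        -- so by maximality of the matching it is not an end of another bridge.
        separated : ∀ {r r′} → Origin r → Origin r′ → Separated r r′
        separated (fromBridge t∈) (fromBridge t′∈) =
          (λ { refl → M.maximal (proj₁ (bridge-ends t′∈)) (proj₂ (bridge-ends t∈)) (proj₂ (T.linked t∈)) }) ,
          (λ { refl → M.maximal (proj₁ (bridge-ends t∈)) (proj₂ (bridge-ends t′∈)) (proj₁ (T.linked t∈)) })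
        separated (fromDirect _) _ = tt
        separated (fromCommon _) _ = tt
        separated (fromPair _) _ = tt
        separated (fromBridge _) (fromDirect _) = tt
        separated (fromBridge _) (fromCommon _) = tt
        separated (fromBridge _) (fromPair _) = tt

        direct-distinct : ∀ d (f : Route → Fin n) → Unique (map f (directRoutes d))
        direct-distinct (yes _) f = [] ∷ []
        direct-distinct (no _)  f = []

        ∈directRoutes : ∀ {d r} → r ∈ directRoutes d → r ≡ direct
        ∈directRoutes {yes _} (here r≡direct) = r≡direct

        uniqueV : Unique (proj₁ degV)
        uniqueV = proj₁ (proj₂ degV)

        uniqueW : Unique (proj₁ degW)
        uniqueW = proj₁ (proj₂ degW)

        common-distinct : ∀ (f : Route → Fin n) → (∀ x → f (via₁ x) ≡ x) → Unique (map f (map via₁ V.shared))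
        common-distinct f f-via₁ = subst Unique (map-∘ V.shared)
          (Unique.map⁺ (λ {x} {y} e → trans (sym (f-via₁ x)) (trans e (f-via₁ y)))
                       (V.shared-distinct uniqueV))

        seconds-distinct : Unique (map second routes)
        seconds-distinct =
          Unique-map-++⁺ second directs (direct-distinct _ second)
            (Unique-map-++⁺ second (map via₁ V.shared) (common-distinct second λ _ → refl)
              long-distinct common≢long)
            direct≢rest
          where
          long-distinct : Unique (map second longRoutes)
          long-distinct = subst Unique (sym (map-longRoutes second))
            (Unique-prefix (map proj₁ M.pairs) (map left T.bridges)
              (↭-trans (++⁺ˡ _ T.coverA) M.coverA) (V.exclusive-distinct uniqueV))
          common≢long : ∀ {r r′} → r ∈ map via₁ V.shared → r′ ∈ longRoutes → second r ≢ second r′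
          common≢long r∈ r′∈ with x , x∈ , refl ← ∈-map⁻ via₁ r∈ = λ { refl →
            proj₂ (proj₂ (V.exclusive⇒ (proj₁ (long-ends r′∈)))) (proj₂ (proj₂ (V.shared⇒ x∈))) }
          direct≢rest : ∀ {r r′} → r ∈ directs → r′ ∈ map via₁ V.shared ++ longRoutes →
            second r ≢ second r′
          direct≢rest r∈ r′∈ with refl ← ∈directRoutes r∈ | ∈-++⁻ (map via₁ V.shared) r′∈
          ... | inj₁ r′∈common with x , x∈ , refl ← ∈-map⁻ via₁ r′∈common = proj₁ (proj₂ (V.shared⇒ x∈)) ∘ sym
          ... | inj₂ r′∈long = proj₁ (proj₂ (V.exclusive⇒ (proj₁ (long-ends r′∈long)))) ∘ sym

        penultimates-distinct : Unique (map penultimate routes)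
        penultimates-distinct =
          Unique-map-++⁺ penultimate directs (direct-distinct _ penultimate)
            (Unique-map-++⁺ penultimate (map via₁ V.shared) (common-distinct penultimate λ _ → refl)
              long-distinct common≢long)
            direct≢rest
          where
          long-distinct : Unique (map penultimate longRoutes)
          long-distinct = subst Unique (sym (map-longRoutes penultimate))
            (Unique-prefix (map proj₂ M.pairs) (map right T.bridges)
              (↭-trans (++⁺ˡ _ T.coverB) M.coverB) (W.exclusive-distinct uniqueW))
          common≢long : ∀ {r r′} → r ∈ map via₁ V.shared → r′ ∈ longRoutes → penultimate r ≢ penultimate r′
          common≢long r∈ r′∈ with x , x∈ , refl ← ∈-map⁻ via₁ r∈ = λ { refl →
            proj₂ (proj₂ (W.exclusive⇒ (proj₂ (long-ends r′∈)))) (nbrV (proj₁ (V.shared⇒ x∈))) }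
          direct≢rest : ∀ {r r′} → r ∈ directs → r′ ∈ map via₁ V.shared ++ longRoutes →
            penultimate r ≢ penultimate r′
          direct≢rest r∈ r′∈ with refl ← ∈directRoutes r∈ | ∈-++⁻ (map via₁ V.shared) r′∈
          ... | inj₁ r′∈common with x , x∈ , refl ← ∈-map⁻ via₁ r′∈common = adj⇒≢ (nbrV (proj₁ (V.shared⇒ x∈)))
          ... | inj₂ r′∈long = proj₁ (proj₂ (W.exclusive⇒ (proj₂ (long-ends r′∈long)))) ∘ sym

        equalV≤ : ∀ d → length V.equal ≤ length (directRoutes d)
        equalV≤ (yes _) = Unique⇒length-≤ {ys = [ w ]} (V.equal-distinct uniqueV) λ x∈ →
          here (proj₂ (V.equal⇒ x∈))
        equalV≤ (no ¬vw) = Unique⇒length-≤ {ys = []} (V.equal-distinct uniqueV) λ x∈ →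
          ⊥-elim (¬vw (subst (Adj v) (proj₂ (V.equal⇒ x∈)) (nbrV (proj₁ (V.equal⇒ x∈)))))

        equalW≤ : ∀ d → length W.equal ≤ length (directRoutes d)
        equalW≤ (yes _) = Unique⇒length-≤ {ys = [ v ]} (W.equal-distinct uniqueW) λ x∈ →
          here (proj₂ (W.equal⇒ x∈))
        equalW≤ (no ¬vw) = Unique⇒length-≤ {ys = []} (W.equal-distinct uniqueW) λ x∈ →
          ⊥-elim (¬vw (Adj-sym (subst (Adj w) (proj₂ (W.equal⇒ x∈)) (nbrW (proj₁ (W.equal⇒ x∈))))))

        sharedW≤sharedV : length W.shared ≤ length V.shared
        sharedW≤sharedV = Unique⇒length-≤ (W.shared-distinct uniqueW) λ x∈ →
          let x∈nsW , _ , vx = W.shared⇒ x∈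
              wx = nbrW x∈nsW
          in V.shared⇐ (nbrV⁻¹ vx) (adj⇒≢ wx ∘ sym) wx

        length-routes :
          length routes ≡ length directs + (length V.shared + (length M.pairs + length T.bridges))
        length-routes = begin
          length routes
            ≡⟨ length-++ directs ⟩
          length directs + length (map via₁ V.shared ++ longRoutes)
            ≡⟨ cong (length directs +_) (length-++ (map via₁ V.shared)) ⟩
          length directs + (length (map via₁ V.shared) + length longRoutes)
            ≡⟨ cong (λ k → length directs + (length (map via₁ V.shared) + k))
                 (length-++ (map pairRoute M.pairs)) ⟩
          length directs +
            (length (map via₁ V.shared) + (length (map pairRoute M.pairs) + length (map bridgeRoute T.bridges)))
            ≡⟨ cong₂ (λ k l → length directs + (k + l)) (length-map via₁ V.shared)
                 (cong₂ _+_ (length-map pairRoute M.pairs) (length-map bridgeRoute T.bridges)) ⟩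
          length directs + (length V.shared + (length M.pairs + length T.bridges)) ∎
          where open ≡-Reasoning

        dv≡ : dv ≡ length V.equal + (length V.shared + (length M.pairs + length M.unmatchedA))
        dv≡ = trans (sym (proj₁ (proj₂ (proj₂ degV)))) (trans V.size
          (cong (λ k → length V.equal + (length V.shared + k))
                (length-cover proj₁ M.pairs M.unmatchedA M.coverA)))

        dw≡ : dw ≡ length W.equal + (length W.shared + (length M.pairs + length M.unmatchedB))
        dw≡ = trans (sym (proj₁ (proj₂ (proj₂ degW)))) (trans W.size
          (cong (λ k → length W.equal + (length W.shared + k))
                (length-cover proj₂ M.pairs M.unmatchedB M.coverB)))

        enoughRoutes : dv ⊓ dw ≤ length routes
        enoughRoutes = begin
          dv ⊓ dw
            ≡⟨ cong₂ _⊓_ dv≡ dw≡ ⟩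
          (length V.equal + (length V.shared + (length M.pairs + length M.unmatchedA))) ⊓
          (length W.equal + (length W.shared + (length M.pairs + length M.unmatchedB)))
            ≤⟨ ⊓-of-sums-≤ (length M.pairs) (length M.unmatchedA) (length M.unmatchedB)
                 (equalV≤ (Adj? v w)) (equalW≤ (Adj? v w)) sharedW≤sharedV ⟩
          length directs +
            (length V.shared + (length M.pairs + length M.unmatchedA ⊓ length M.unmatchedB))
            ≡⟨ cong (λ k → length directs + (length V.shared + (length M.pairs + k))) T.count ⟨
          length directs + (length V.shared + (length M.pairs + length T.bridges))
            ≡⟨ length-routes ⟨
          length routes ∎
          where open ≤-Reasoning

        paths : ShortEdgeDisjointPaths (dv ⊓ dw) v w
        paths = routePaths routes (All.tabulate (admissible ∘ origin))
          (λ r∈ r′∈ → separated (origin r∈) (origin r′∈))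
          seconds-distinct penultimates-distinct (dv ⊓ dw) enoughRoutes

    shortEdgeDisjointPaths : ∀ v w → v ≢ w → ∀ {dv dw} → HasDegree v dv → HasDegree w dw →
      ShortEdgeDisjointPaths (dv ⊓ dw) v w
    shortEdgeDisjointPaths v w v≢w degV degW = Between.Routes.paths v w v≢w degV degW

module IntegerCoefficients {a ℓ} (R : CommutativeRing a ℓ) where

  open import Data.Nat as ℕ using (ℕ; zero; suc; _∸_)
  import Data.Nat.Properties as ℕ
  open import Data.Integer as ℤ using (ℤ; +_; -[1+_]; _⊖_; _◃_; sign; ∣_∣)
  import Data.Integer.Properties as ℤ
  open import Data.Sign as Sign using (Sign)
  open import Data.Sum using (inj₁; inj₂)
  open import Data.Maybe using (Maybe; just; nothing)
  open import Relation.Nullary using (yes; no)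
  open import Relation.Binary.PropositionalEquality as ≡ using (_≡_)
  open import Algebra.Solver.Ring.AlmostCommutativeRing
    using (fromCommutativeRing; _-Raw-AlmostCommutative⟶_)

  open CommutativeRing R
  open import Algebra.Properties.Ring ring using (-‿involutive; -0#≈0#; -‿+-comm; -1*x≈-x; xyx⁻¹≈y)
  open import Algebra.Properties.Semiring.Mult.TCOptimised semiring using (×-homo-+; ×1-homo-*)
    renaming (_×_ to _·_)
  open import Algebra.Properties.CommutativeSemigroup *-commutativeSemigroup using (interchange)
  open import Relation.Binary.Reasoning.Setoid setoid

  embed : ℤ → Carrier
  embed (+ n)      = n · 1#
  embed (-[1+ n ]) = - (suc n · 1#)

  embed-neg : ∀ i → embed (ℤ.- i) ≈ - embed i
  embed-neg (+ zero)   = sym -0#≈0#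
  embed-neg (+ suc n)  = refl
  embed-neg -[1+ n ]   = sym (-‿involutive _)

  embed-⊖ : ∀ m n → embed (m ⊖ n) ≈ m · 1# - n · 1#
  embed-⊖ m n with ℕ.≤-total n m
  ... | inj₁ n≤m = begin
    embed (m ⊖ n)                    ≡⟨ ≡.cong embed (ℤ.⊖-≥ n≤m) ⟩
    (m ∸ n) · 1#                     ≈⟨ xyx⁻¹≈y (n · 1#) _ ⟨
    n · 1# + (m ∸ n) · 1# - n · 1#   ≈⟨ +-congʳ (×-homo-+ 1# n (m ∸ n)) ⟨
    (n ℕ.+ (m ∸ n)) · 1# - n · 1#    ≡⟨ ≡.cong (λ k → k · 1# - n · 1#) (ℕ.m+[n∸m]≡n n≤m) ⟩
    m · 1# - n · 1#                  ∎
  ... | inj₂ m≤n = begin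
    embed (m ⊖ n)                          ≡⟨ ≡.cong embed (ℤ.⊖-≤ m≤n) ⟩
    embed (ℤ.- (+ (n ∸ m)))                ≈⟨ embed-neg (+ (n ∸ m)) ⟩
    - ((n ∸ m) · 1#)                       ≈⟨ +-identityˡ _ ⟨
    0# - (n ∸ m) · 1#                      ≈⟨ +-congʳ (-‿inverseʳ (m · 1#)) ⟨
    (m · 1# - m · 1#) - (n ∸ m) · 1#       ≈⟨ +-assoc _ _ _ ⟩
    m · 1# + (- (m · 1#) - (n ∸ m) · 1#)   ≈⟨ +-congˡ (-‿+-comm _ _) ⟩
    m · 1# - (m · 1# + (n ∸ m) · 1#)       ≈⟨ +-congˡ (-‿cong (×-homo-+ 1# m (n ∸ m))) ⟨
    m · 1# - (m ℕ.+ (n ∸ m)) · 1#          ≡⟨ ≡.cong (λ k → m · 1# - k · 1#) (ℕ.m+[n∸m]≡n m≤n) ⟩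
    m · 1# - n · 1#                        ∎

  embed-+ : ∀ i j → embed (i ℤ.+ j) ≈ embed i + embed j
  embed-+ (+ m)    (+ n)    = ×-homo-+ 1# m n
  embed-+ (+ m)    -[1+ n ] = embed-⊖ m (suc n)
  embed-+ -[1+ m ] (+ n)    = trans (embed-⊖ n (suc m)) (+-comm _ _)
  embed-+ -[1+ m ] -[1+ n ] = begin
    - (suc (suc (m ℕ.+ n)) · 1#)    ≡⟨ ≡.cong (λ k → - (suc k · 1#)) (ℕ.+-suc m n) ⟨
    - ((suc m ℕ.+ suc n) · 1#)      ≈⟨ -‿cong (×-homo-+ 1# (suc m) (suc n)) ⟩
    - (suc m · 1# + suc n · 1#)     ≈⟨ -‿+-comm _ _ ⟨
    - (suc m · 1#) - suc n · 1#     ∎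

  sgn : Sign → Carrier
  sgn Sign.+ = 1#
  sgn Sign.- = - 1#

  embed-◃ : ∀ s k → embed (s ◃ k) ≈ sgn s * (k · 1#)
  embed-◃ s       zero    = sym (zeroʳ _)
  embed-◃ Sign.+ (suc k) = sym (*-identityˡ _)
  embed-◃ Sign.- (suc k) = sym (-1*x≈-x _)

  sgn-* : ∀ s t → sgn (s Sign.* t) ≈ sgn s * sgn t
  sgn-* Sign.+ t      = sym (*-identityˡ _)
  sgn-* Sign.- Sign.+ = sym (*-identityʳ _)
  sgn-* Sign.- Sign.- = sym (trans (-1*x≈-x (- 1#)) (-‿involutive 1#))

  embed-* : ∀ i j → embed (i ℤ.* j) ≈ embed i * embed j
  embed-* i j = begin
    embed ((sign i Sign.* sign j) ◃ (∣ i ∣ ℕ.* ∣ j ∣))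
      ≈⟨ embed-◃ (sign i Sign.* sign j) (∣ i ∣ ℕ.* ∣ j ∣) ⟩
    sgn (sign i Sign.* sign j) * ((∣ i ∣ ℕ.* ∣ j ∣) · 1#)
      ≈⟨ *-cong (sgn-* (sign i) (sign j)) (×1-homo-* ∣ i ∣ ∣ j ∣) ⟩
    (sgn (sign i) * sgn (sign j)) * (∣ i ∣ · 1# * ∣ j ∣ · 1#)
      ≈⟨ interchange _ _ _ _ ⟩
    (sgn (sign i) * ∣ i ∣ · 1#) * (sgn (sign j) * ∣ j ∣ · 1#)
      ≈⟨ *-cong (embed-◃ (sign i) ∣ i ∣) (embed-◃ (sign j) ∣ j ∣) ⟨
    embed (sign i ◃ ∣ i ∣) * embed (sign j ◃ ∣ j ∣)
      ≡⟨ ≡.cong₂ (λ i′ j′ → embed i′ * embed j′) (ℤ.◃-inverse i) (ℤ.◃-inverse j) ⟩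
    embed i * embed j ∎

  homomorphism : ℤ.+-*-rawRing -Raw-AlmostCommutative⟶ fromCommutativeRing R
  homomorphism = record
    { ⟦_⟧ = embed ; +-homo = embed-+ ; *-homo = embed-* ; -‿homo = embed-neg
    ; 0-homo = refl ; 1-homo = refl }

  _≟ᶜ_ : ∀ i j → Maybe (embed i ≈ embed j)
  i ≟ᶜ j with i ℤ.≟ j
  ... | yes ≡.refl = just refl
  ... | no _       = nothing

  open import Algebra.Solver.Ring ℤ.+-*-rawRing (fromCommutativeRing R) homomorphism _≟ᶜ_ public

module PlaneGeometry (ℝ : RealField) where

  open import Data.Nat using (ℕ; zero; suc)
  open import Data.Fin using (Fin; zero; suc)
  open import Data.Fin.Properties using (_≟_; any?; all?)
  open import Data.Integer using (+_)
  open import Data.Product using (∃; ∃-syntax; _×_; _,_; proj₁; proj₂)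
  open import Function using (_∘_)
  open import Data.Sum using (inj₁; inj₂)
  open import Algebra.Bundles using (CommutativeRing)
  open import Relation.Nullary using (¬_; Dec; yes; no; ¬?; contradiction)
  open import Relation.Nullary.Decidable using (map′; _×-dec_)
  open import Relation.Binary.PropositionalEquality
    using (_≡_; _≢_; refl; sym; trans; cong; cong₂; subst; subst₂; module ≡-Reasoning)
  open ≡-Reasoning

  open RealField ℝ
  open Plane ℝ

  commutativeRing : CommutativeRing _ _
  commutativeRing = record { isCommutativeRing = isCommutativeRing }

  open CommutativeRing commutativeRing using (+-identityˡ; +-identityʳ; -‿inverseʳ; *-identityʳ)
  open IntegerCoefficients commutativeRing using (Polynomial; solve; _:=_; _:+_; _:-_; :-_; _:*_; con)

  <⇒≢ : ∀ {x y} → x < y → x ≢ y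
  <⇒≢ {x} x<x refl = <-irrefl x x<x

  _≟ʳ_ : (x y : R) → Dec (x ≡ y)
  x ≟ʳ y with <-trichotomy x y
  ... | inj₁ x<y        = no (<⇒≢ x<y)
  ... | inj₂ (inj₁ x≡y) = yes x≡y
  ... | inj₂ (inj₂ y<x) = no (<⇒≢ y<x ∘ sym)

  _<?_ : (x y : R) → Dec (x < y)
  x <? y with <-trichotomy x y
  ... | inj₁ x<y        = yes x<y
  ... | inj₂ (inj₁ refl) = no (<-irrefl x)
  ... | inj₂ (inj₂ y<x) = no (λ x<y → <-irrefl x (<-trans x<y y<x))

  x<y⇒0<y-x : ∀ {x y} → x < y → 0# < y -ʳ x
  x<y⇒0<y-x {x} {y} x<y = subst (_< y -ʳ x) (-‿inverseʳ x) (+-mono-< (- x) x<y)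

  0<y-x⇒x<y : ∀ {x y} → 0# < y -ʳ x → x < y
  0<y-x⇒x<y {x} {y} 0<y-x = subst₂ _<_ (+-identityˡ x)
    (solve 2 (λ y x → (y :- x) :+ x := y) refl y x) (+-mono-< x 0<y-x)

  x≢0⇒0<x*x : ∀ x → x ≢ 0# → 0# < x * x
  x≢0⇒0<x*x x x≢0 with <-trichotomy x 0#
  ... | inj₁ x<0 = subst (0# <_) (solve 1 (λ x → (:- x) :* (:- x) := x :* x) refl x) (*-pos 0<-x 0<-x)
    where
    0<-x : 0# < - x
    0<-x = subst (0# <_) (+-identityˡ (- x)) (x<y⇒0<y-x x<0)
  ... | inj₂ (inj₁ x≡0) = contradiction x≡0 x≢0
  ... | inj₂ (inj₂ 0<x) = *-pos 0<x 0<x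

  s*y<y : ∀ {s y} → 0# < y → s < 1# → s * y < y
  s*y<y {s} {y} 0<y s<1 = 0<y-x⇒x<y (subst (0# <_)
    (solve 2 (λ s y → (con (+ 1) :- s) :* y := y :- s :* y) refl s y) (*-pos (x<y⇒0<y-x s<1) 0<y))

  *-≢0 : ∀ {x y} → x ≢ 0# → y ≢ 0# → x * y ≢ 0#
  *-≢0 {x} {y} x≢0 y≢0 xy≡0 with x⁻¹ , xx⁻¹≡1 ← inverse x x≢0 = y≢0 (begin
    y                ≡⟨ solve 1 (λ y → y := con (+ 1) :* y) refl y ⟩
    1# * y           ≡⟨ cong (_* y) xx⁻¹≡1 ⟨
    (x * x⁻¹) * y    ≡⟨ solve 3 (λ x x⁻¹ y → (x :* x⁻¹) :* y := x⁻¹ :* (x :* y)) refl x x⁻¹ y ⟩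
    x⁻¹ * (x * y)    ≡⟨ cong (x⁻¹ *_) xy≡0 ⟩
    x⁻¹ * 0#         ≡⟨ solve 1 (λ z → z :* con (+ 0) := con (+ 0)) refl x⁻¹ ⟩
    0#               ∎)

  x-y≡0⇒x≡y : ∀ {x y} → x -ʳ y ≡ 0# → x ≡ y
  x-y≡0⇒x≡y {x} {y} x-y≡0 = trans (sym (solve 2 (λ x y → (x :- y) :+ y := x) refl x y))
    (trans (cong (_+ y) x-y≡0) (+-identityˡ y))

  1-t∈⟨0,1⟩ : ∀ {t} → 0# < t → t < 1# → 0# < 1# -ʳ t × 1# -ʳ t < 1#
  1-t∈⟨0,1⟩ {t} 0<t t<1 = x<y⇒0<y-x t<1 , 0<y-x⇒x<y (subst (0# <_) t≡1-[1-t] 0<t)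
    where
    t≡1-[1-t] : t ≡ 1# -ʳ (1# -ʳ t)
    t≡1-[1-t] = solve 1 (λ t → t := con (+ 1) :- (con (+ 1) :- t)) refl t

  segment-sym : ∀ p a b → InOpenSegment p a b → InOpenSegment p b a
  segment-sym (px , py) (ax , ay) (bx , by) (t , 0<t , t<1 , px≡ , py≡) =
    1# -ʳ t , proj₁ bounds , proj₂ bounds , trans px≡ (reverse ax bx t) , trans py≡ (reverse ay by t)
    where
    bounds = 1-t∈⟨0,1⟩ 0<t t<1
    reverse : ∀ a b t → a + t * (b -ʳ a) ≡ b + (1# -ʳ t) * (a -ʳ b)
    reverse = solve 3 (λ a b t → a :+ t :* (b :- a) := b :+ (con (+ 1) :- t) :* (a :- b)) refl

  -- When a and b differ in x-coordinate, the x-coordinate of p forces the parameter t,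
  -- so a single candidate t₀ has to be tested.
  inOpenSegment-x? : ∀ p a b → proj₁ b -ʳ proj₁ a ≢ 0# → Dec (InOpenSegment p a b)
  inOpenSegment-x? (px , py) (ax , ay) (bx , by) d≢0 with e , de≡1 ← inverse (bx -ʳ ax) d≢0 =
    map′ (λ (0<t₀ , t₀<1 , py≡) → t₀ , 0<t₀ , t₀<1 , px≡ , py≡)
         (λ (t , 0<t , t<1 , px≡′ , py≡′) →
           subst (λ s → 0# < s × s < 1# × py ≡ ay + s * (by -ʳ ay)) (forced t px≡′) (0<t , t<1 , py≡′))
         ((0# <? t₀) ×-dec (t₀ <? 1#) ×-dec (py ≟ʳ (ay + t₀ * (by -ʳ ay))))
    where
    d = bx -ʳ ax
    t₀ = (px -ʳ ax) * e
    px≡ : px ≡ ax + t₀ * d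
    px≡ = sym (begin
      ax + ((px -ʳ ax) * e) * d
        ≡⟨ solve 4 (λ a p e d → a :+ ((p :- a) :* e) :* d := a :+ (p :- a) :* (d :* e)) refl ax px e d ⟩
      ax + (px -ʳ ax) * (d * e) ≡⟨ cong (λ z → ax + (px -ʳ ax) * z) de≡1 ⟩
      ax + (px -ʳ ax) * 1#      ≡⟨ solve 2 (λ a p → a :+ (p :- a) :* con (+ 1) := p) refl ax px ⟩
      px                        ∎)
    forced : ∀ t → px ≡ ax + t * d → t ≡ t₀
    forced t px≡′ = sym (begin
      (px -ʳ ax) * e             ≡⟨ cong (λ z → (z -ʳ ax) * e) px≡′ ⟩
      ((ax + t * d) -ʳ ax) * e
        ≡⟨ solve 4 (λ a t d e → ((a :+ t :* d) :- a) :* e := t :* (d :* e)) refl ax t d e ⟩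
      t * (d * e)                ≡⟨ cong (t *_) de≡1 ⟩
      t * 1#                     ≡⟨ *-identityʳ t ⟩
      t                          ∎)

  inOpenSegment? : ∀ p a b → a ≢ b → Dec (InOpenSegment p a b)
  inOpenSegment? p a b a≢b with (proj₁ b -ʳ proj₁ a) ≟ʳ 0# | (proj₂ b -ʳ proj₂ a) ≟ʳ 0#
  ... | no dx≢0 | _ = inOpenSegment-x? p a b dx≢0
  ... | yes _ | no dy≢0 =
    map′ swapCoordinates swapCoordinates (inOpenSegment-x? (flip p) (flip a) (flip b) dy≢0)
    where
    flip : Point → Point
    flip (x , y) = y , x
    swapCoordinates : ∀ {p a b} → InOpenSegment p a b → InOpenSegment (flip p) (flip a) (flip b)
    swapCoordinates {_ , _} {_ , _} {_ , _} (t , 0<t , t<1 , x≡ , y≡) = t , 0<t , t<1 , y≡ , x≡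
  ... | yes dx≡0 | yes dy≡0 = contradiction (sym (cong₂ _,_ (x-y≡0⇒x≡y dx≡0) (x-y≡0⇒x≡y dy≡0))) a≢b

  cross : Point → Point → Point → R
  cross (ax , ay) (bx , by) (px , py) = ((bx -ʳ ax) * (py -ʳ ay)) -ʳ ((by -ʳ ay) * (px -ʳ ax))

  crossₚ : ∀ {k} (ax ay bx by px py : Polynomial k) → Polynomial k
  crossₚ ax ay bx by px py = ((bx :- ax) :* (py :- ay)) :- ((by :- ay) :* (px :- ax))

  cross-start : ∀ a b → cross a b a ≡ 0#
  cross-start (ax , ay) (bx , by) =
    solve 4 (λ ax ay bx by → crossₚ ax ay bx by ax ay := con (+ 0)) refl ax ay bx by

  cross-end : ∀ a b → cross a b b ≡ 0#
  cross-end (ax , ay) (bx , by) =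
    solve 4 (λ ax ay bx by → crossₚ ax ay bx by bx by := con (+ 0)) refl ax ay bx by

  cross≡0⇒collinear : ∀ i j l → cross i j l ≡ 0# → Collinear₃ i j l
  cross≡0⇒collinear (ix , iy) (jx , jy) (lx , ly) = x-y≡0⇒x≡y

  collinear-repeated : ∀ i l → Collinear₃ i i l
  collinear-repeated (ix , iy) (lx , ly) =
    solve 4 (λ ix iy lx ly → (ix :- ix) :* (ly :- iy) := (iy :- iy) :* (lx :- ix)) refl ix iy lx ly

  cross-on-segment : ∀ a b {p m q} → InOpenSegment p m q → cross a b q ≡ 0# →
    ∃[ t ] (0# < t × t < 1# × cross a b p ≡ (1# -ʳ t) * cross a b m)
  cross-on-segment (ax , ay) (bx , by) {px , py} {mx , my} {qx , qy} (t , 0<t , t<1 , refl , refl) q≡0 =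
    t , 0<t , t<1 , (begin
      cross a b p                                      ≡⟨ affine ax ay bx by mx my qx qy t ⟩
      (1# -ʳ t) * cross a b m + t * cross a b q        ≡⟨ cong (λ z → (1# -ʳ t) * cross a b m + t * z) q≡0 ⟩
      (1# -ʳ t) * cross a b m + t * 0#                 ≡⟨ solve 2 (λ x t → x :+ t :* con (+ 0) := x) refl _ t ⟩
      (1# -ʳ t) * cross a b m                          ∎)
    where
    a = ax , ay
    b = bx , by
    m = mx , my
    q = qx , qy
    p = mx + t * (qx -ʳ mx) , my + t * (qy -ʳ my)
    affine : ∀ ax ay bx by mx my qx qy t →
      cross (ax , ay) (bx , by) (mx + t * (qx -ʳ mx) , my + t * (qy -ʳ my)) ≡
      (1# -ʳ t) * cross (ax , ay) (bx , by) (mx , my) + t * cross (ax , ay) (bx , by) (qx , qy)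
    affine = solve 9 (λ ax ay bx by mx my qx qy t →
      crossₚ ax ay bx by (mx :+ t :* (qx :- mx)) (my :+ t :* (qy :- my)) :=
      (con (+ 1) :- t) :* crossₚ ax ay bx by mx my :+ t :* crossₚ ax ay bx by qx qy) refl

  cross-expansion : ∀ a b i j l →
    ((proj₁ b -ʳ proj₁ a) * cross i j l ≡
      ((proj₁ j -ʳ proj₁ i) * (cross a b l -ʳ cross a b i)) -ʳ
      ((proj₁ l -ʳ proj₁ i) * (cross a b j -ʳ cross a b i)))
    × ((proj₂ b -ʳ proj₂ a) * cross i j l ≡
      ((proj₂ j -ʳ proj₂ i) * (cross a b l -ʳ cross a b i)) -ʳ
      ((proj₂ l -ʳ proj₂ i) * (cross a b j -ʳ cross a b i)))
  cross-expansion (ax , ay) (bx , by) (ix , iy) (jx , jy) (lx , ly) =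
    solve 10 (λ ax ay bx by ix iy jx jy lx ly →
      (bx :- ax) :* crossₚ ix iy jx jy lx ly :=
      ((jx :- ix) :* (crossₚ ax ay bx by lx ly :- crossₚ ax ay bx by ix iy))
        :- ((lx :- ix) :* (crossₚ ax ay bx by jx jy :- crossₚ ax ay bx by ix iy)))
      refl ax ay bx by ix iy jx jy lx ly ,
    solve 10 (λ ax ay bx by ix iy jx jy lx ly →
      (by :- ay) :* crossₚ ix iy jx jy lx ly :=
      ((jy :- iy) :* (crossₚ ax ay bx by lx ly :- crossₚ ax ay bx by ix iy))
        :- ((ly :- iy) :* (crossₚ ax ay bx by jx jy :- crossₚ ax ay bx by ix iy)))
      refl ax ay bx by ix iy jx jy lx ly

  onLine⇒collinear : ∀ {a b} → a ≢ b → ∀ i j l →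
    cross a b i ≡ 0# → cross a b j ≡ 0# → cross a b l ≡ 0# → Collinear₃ i j l
  onLine⇒collinear {a} {b} a≢b i j l i≡0 j≡0 l≡0 = cross≡0⇒collinear i j l cross≡0
    where
    vanishes : ∀ u w → (u * (cross a b l -ʳ cross a b i)) -ʳ (w * (cross a b j -ʳ cross a b i)) ≡ 0#
    vanishes u w = begin
      (u * (cross a b l -ʳ cross a b i)) -ʳ (w * (cross a b j -ʳ cross a b i))
        ≡⟨ cong₂ (λ x y → (u * (x -ʳ y)) -ʳ (w * (cross a b j -ʳ y))) l≡0 i≡0 ⟩
      (u * (0# -ʳ 0#)) -ʳ (w * (cross a b j -ʳ 0#))
        ≡⟨ cong (λ x → (u * (0# -ʳ 0#)) -ʳ (w * (x -ʳ 0#))) j≡0 ⟩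
      (u * (0# -ʳ 0#)) -ʳ (w * (0# -ʳ 0#))
        ≡⟨ solve 2 (λ u w → (u :* (con (+ 0) :- con (+ 0))) :- (w :* (con (+ 0) :- con (+ 0))) := con (+ 0))
                   refl u w ⟩
      0# ∎
    cross≡0 : cross i j l ≡ 0#
    cross≡0 with cross i j l ≟ʳ 0# | (proj₁ b -ʳ proj₁ a) ≟ʳ 0# | (proj₂ b -ʳ proj₂ a) ≟ʳ 0#
    ... | yes c≡0 | _ | _ = c≡0
    ... | no c≢0 | no dx≢0 | _ =
      contradiction (trans (proj₁ (cross-expansion a b i j l)) (vanishes _ _)) (*-≢0 dx≢0 c≢0)
    ... | no c≢0 | yes _ | no dy≢0 =
      contradiction (trans (proj₂ (cross-expansion a b i j l)) (vanishes _ _)) (*-≢0 dy≢0 c≢0)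
    ... | no _ | yes dx≡0 | yes dy≡0 = contradiction (sym (cong₂ _,_ (x-y≡0⇒x≡y dx≡0) (x-y≡0⇒x≡y dy≡0))) a≢b

  ≮-trans : ∀ {x y z} → ¬ y < z → ¬ x < y → ¬ x < z
  ≮-trans {x} {y} y≮z x≮y x<z with <-trichotomy x y
  ... | inj₁ x<y = x≮y x<y
  ... | inj₂ (inj₁ refl) = y≮z x<z
  ... | inj₂ (inj₂ y<x) = y≮z (<-trans y<x x<z)

  argmin : ∀ {m} (f : Fin m → R) (Q : Fin m → Set) → (∀ k → Dec (Q k)) → ∃ Q →
    ∃[ k ] (Q k × ∀ j → Q j → ¬ f j < f k)
  argmin {suc m} f Q Q? (k₀ , qk₀) with any? (λ j → Q? (suc j))
  ... | no none = zero , q₀ k₀ qk₀ , λ { zero _ → <-irrefl _ ; (suc j) qj → contradiction (j , qj) none }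
    where
    q₀ : ∀ k → Q k → Q zero
    q₀ zero qk = qk
    q₀ (suc k) qk = contradiction (k , qk) none
  ... | yes some with k , qk , minimal ← argmin (λ j → f (suc j)) (λ j → Q (suc j)) (λ j → Q? (suc j)) some
                 with Q? zero
  ...   | no ¬q₀ = suc k , qk , λ { zero q₀ → contradiction q₀ ¬q₀ ; (suc j) → minimal j }
  ...   | yes q₀ with f (suc k) <? f zero
  ...     | yes fk<f₀ =
    suc k , qk , λ { zero _ f₀<fk → <-irrefl _ (<-trans f₀<fk fk<f₀) ; (suc j) → minimal j }
  ...     | no fk≮f₀ = zero , q₀ , λ { zero _ → <-irrefl _ ; (suc j) qj → ≮-trans fk≮f₀ (minimal j qj) }

  module Visibility {n : ℕ} (P : Fin n → Point) (P-injective : ∀ i j → P i ≡ P j → i ≡ j) where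

    open PointSet ℝ P

    visible? : ∀ v w → Dec (Visible v w)
    visible? v w with v ≟ w
    ... | yes v≡w = no (λ (v≢w , _) → v≢w v≡w)
    ... | no v≢w = map′ (v≢w ,_) proj₂
      (all? λ k → ¬? (inOpenSegment? (P k) (P v) (P w) (v≢w ∘ P-injective v w)))

    visible-sym : ∀ {v w} → Visible v w → Visible w v
    visible-sym {v} {w} (v≢w , clear) = v≢w ∘ sym , λ k → clear k ∘ segment-sym (P k) (P w) (P v)

    visible-irrefl : ∀ {v} → ¬ Visible v v
    visible-irrefl (v≢v , _) = v≢v refl

    twoPoints : NonCollinear → ∃[ a ] ∃[ b ] a ≢ b
    twoPoints (i , j , l , ¬collinear) with i ≟ j
    ... | no i≢j = i , j , i≢j
    ... | yes refl = contradiction (collinear-repeated (P i) (P l)) ¬collinear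

    -- (cross a b)² measures the distance to the line ab, and it shrinks by the factor (1 - t)²
    -- along a segment from c towards a point of the line.
    commonVisibleNeighbour : NonCollinear → ∀ a b → a ≢ b → ∃[ c ] (Visible a c × Visible c b)
    commonVisibleNeighbour (i , j , l , ¬collinear) a b a≢b =
      c , (a≢c , λ k → unobstructed (P a) (cross-start (P a) (P b)) k ∘ segment-sym (P k) (P a) (P c))
        , (c≢b , unobstructed (P b) (cross-end (P a) (P b)))
      where
      K : Fin n → R
      K k = cross (P a) (P b) (P k)
      Pa≢Pb : P a ≢ P b
      Pa≢Pb = a≢b ∘ P-injective a b
      offLine : ∃[ k ] K k ≢ 0#
      offLine with K i ≟ʳ 0# | K j ≟ʳ 0# | K l ≟ʳ 0#
      ... | no Ki≢0 | _ | _ = i , Ki≢0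
      ... | yes _ | no Kj≢0 | _ = j , Kj≢0
      ... | yes _ | yes _ | no Kl≢0 = l , Kl≢0
      ... | yes Ki≡0 | yes Kj≡0 | yes Kl≡0 =
        contradiction (onLine⇒collinear Pa≢Pb (P i) (P j) (P l) Ki≡0 Kj≡0 Kl≡0) ¬collinear
      closest = argmin (λ k → K k * K k) (λ k → K k ≢ 0#) (λ k → ¬? (K k ≟ʳ 0#)) offLine
      c = proj₁ closest
      Kc≢0 : K c ≢ 0#
      Kc≢0 = proj₁ (proj₂ closest)
      a≢c : a ≢ c
      a≢c a≡c = Kc≢0 (subst (λ k → K k ≡ 0#) a≡c (cross-start (P a) (P b)))
      c≢b : c ≢ b
      c≢b c≡b = Kc≢0 (subst (λ k → K k ≡ 0#) (sym c≡b) (cross-end (P a) (P b)))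
      unobstructed : ∀ q → cross (P a) (P b) q ≡ 0# → ∀ k → ¬ InOpenSegment (P k) (P c) q
      unobstructed q q≡0 k between with t , 0<t , t<1 , Kk≡ ← cross-on-segment (P a) (P b) between q≡0 =
        proj₂ (proj₂ closest) k (λ Kk≡0 → *-≢0 (<⇒≢ 0<s ∘ sym) Kc≢0 (trans (sym Kk≡) Kk≡0)) closer
        where
        s = 1# -ʳ t
        0<s = proj₁ (1-t∈⟨0,1⟩ 0<t t<1)
        s<1 = proj₂ (1-t∈⟨0,1⟩ 0<t t<1)
        closer : K k * K k < K c * K c
        closer = subst (_< K c * K c)
          (sym (trans (cong₂ _*_ Kk≡ Kk≡)
            (solve 2 (λ s x → (s :* x) :* (s :* x) := (s :* s) :* (x :* x)) refl s (K c))))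
          (s*y<y (x≢0⇒0<x*x (K c) Kc≢0) (<-trans (s*y<y 0<s s<1) s<1))

open Graphs
open PlaneGeometry

corollary3 : (ℝ : RealField) (n : ℕ) (P : Fin n → Plane.Point ℝ) →
    (∀ i j → P i ≡ P j → i ≡ j) →
    PointSet.NonCollinear ℝ P →
    ((δ : ℕ) → Graph.MinDegree (PointSet.Visible ℝ P) δ →
       Graph.EdgeConnectivity (PointSet.Visible ℝ P) δ)
    ×
    ((v w : Fin n) → v ≢ w → (dv dw : ℕ) →
       Graph.HasDegree (PointSet.Visible ℝ P) v dv →
       Graph.HasDegree (PointSet.Visible ℝ P) w dw →
       Σ (Fin (dv ⊓ dw) → Graph.Path (PointSet.Visible ℝ P) v w) (λ ps →
         (∀ i → Graph.Path.len (ps i) ≤ 4) ×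
         (∀ i j → i ≢ j → Graph.EdgeDisjoint (PointSet.Visible ℝ P) (ps i) (ps j))))
corollary3 ℝ n P P-injective nonCollinear =
  minDegree⇒edgeConnectivity (twoPoints nonCollinear)
    (λ v w v≢w degV degW → map₂ proj₂ (shortEdgeDisjointPaths v w v≢w degV degW)) ,
  λ v w v≢w _ _ → shortEdgeDisjointPaths v w v≢w
  where
  open Visibility ℝ P P-injective
  open EdgeCuts visible?
  open DiameterTwo visible? visible-sym visible-irrefl
    (λ a b a≢b _ → commonVisibleNeighbour nonCollinear a b a≢b)
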